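{- For every $n\ge1$, the restriction of the map $\sigma\mapsto\bar\sigma$ to the set $\mathcal D_n$ of permutations of $[n]$ without fixed points is a bijection onto the set $\mathcal G_n$ of permutations $\tau\in\mathfrak S_n$ without successions (i.e. $\tau(1)\ne1$ and $\tau(j)+1\ne\tau(j+1)$ for all $j\in[n-1]$), and it satisfies $E\sigma=M\bar\sigma$.
   Context: $[n]=\{1,\dots,n\}$, $\mathfrak S_n$ the symmetric group on $[n]$, with product $(\sigma\tau)(k)=\sigma(\tau(k))$; $x_+=\max\{0,x\}$. For $\sigma\in\mathfrak S_n$: $E\sigma\in\mathbb N^n$, $E\sigma(k)=(\sigma(k)-(k-1))_+$; with the conventions $\sigma^{ -1}(0)=0$, $\sigma(n+1)=0$, $M\sigma\in\mathbb N^n$, $M\sigma(k)=(\sigma(\sigma^{ -1}(k-1)+1)-(k-1))_+$. Let $\zeta\in\mathfrak S_n$ with $\zeta(k)=k+1$ ($k<n$), $\zeta(n)=1$; for $\tau\in\mathfrak S_n$, $\tilde\tau(k)=\tau(n+1-k)$; $\hat\tau$ is defined by: for $k\in[n]$ let $\bar k$ be the maximum of the $\tau$-orbit of $k$, $q_k=\min\{p\ge0:\tau^p(k)=\bar k\}$, $\Pi_\tau(k)=(\bar k,q_k)$, and $\hat\tau$ is the unique permutation with $\Pi_\tau(\hat\tau(1)),\dots,\Pi_\tau(\hat\tau(n))$ lexicographically increasing. For $\sigma\in\mathfrak S_n$, $\bar\sigma=\tilde{\sigma_2}$ where $\sigma_2=\hat{\sigma_1}$ and $\sigma_1=\sigma\zeta$.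 -}

module Defs where

open import Data.Nat using (ℕ; zero; suc; _+_; _∸_; _<?_; _<ᵇ_; _≡ᵇ_; _⊔_)
open import Data.Bool using (Bool; true; false; if_then_else_; _∧_; _∨_)
open import Data.Fin using (Fin; zero; suc; toℕ; fromℕ<; opposite)
open import Data.Maybe using (Maybe; just; nothing; fromMaybe)
import Data.Maybe as Maybe
open import Data.List using (List; foldr; map; upTo; allFin; length; filter)
open import Function using (_∘_)
open import Relation.Nullary using (yes; no; ¬_)
open import Relation.Binary.PropositionalEquality using (_≡_)

-- Permutations of [n] are handled as functions Fin n → Fin n;
-- Fin index i stands for the element toℕ i + 1 of [n].

findFin : ∀ {n} → (Fin n → Bool) → Maybe (Fin n)
findFin {zero} p = nothing
findFin {suc n} p = if p zero then just zero else Maybe.map suc (findFin (p ∘ suc))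

ζ : ∀ {n} → Fin n → Fin n
ζ {suc m} k with suc (toℕ k) <? suc m
... | yes p = fromℕ< p
... | no _ = zero

tilde : ∀ {n} → (Fin n → Fin n) → Fin n → Fin n
tilde τ = τ ∘ opposite

iter : ∀ {n} → (Fin n → Fin n) → ℕ → Fin n → Fin n
iter τ zero k = k
iter τ (suc p) k = τ (iter τ p k)

-- maximum of the τ-orbit of k (as an element of [n], i.e. toℕ + 1);
-- orbits of a permutation of [n] have size ≤ n, so iterates p < n suffice
orbitMax : ∀ {n} → (Fin n → Fin n) → Fin n → ℕ
orbitMax {n} τ k = foldr _⊔_ 0 (map (λ p → suc (toℕ (iter τ p k))) (upTo n))

firstNat : ℕ → (ℕ → Bool) → ℕ
firstNat zero P = zero
firstNat (suc b) P = if P zero then zero else suc (firstNat b (P ∘ suc))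

qIndex : ∀ {n} → (Fin n → Fin n) → Fin n → ℕ
qIndex {n} τ k = firstNat n (λ p → suc (toℕ (iter τ p k)) ≡ᵇ orbitMax τ k)

ΠLess : ∀ {n} → (Fin n → Fin n) → Fin n → Fin n → Bool
ΠLess τ j k = (orbitMax τ j <ᵇ orbitMax τ k)
              ∨ ((orbitMax τ j ≡ᵇ orbitMax τ k) ∧ (qIndex τ j <ᵇ qIndex τ k))

rank : ∀ {n} → (Fin n → Fin n) → Fin n → ℕ
rank {n} τ k = length (filter (λ j → ΠLess τ j k Data.Bool.≟ true) (allFin n))
  where import Data.Bool

-- τ̂ : τ̂(i) is the k whose Π_τ(k) is the i-th smallest (the unique permutation
-- listing [n] in lex-increasing order of Π_τ); fallback only for non-permutations
hat : ∀ {n} → (Fin n → Fin n) → Fin n → Fin n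
hat τ i = fromMaybe i (findFin (λ k → rank τ k ≡ᵇ toℕ i))

bar : ∀ {n} → (Fin n → Fin n) → Fin n → Fin n
bar σ = tilde (hat (σ ∘ ζ))

ext : ∀ {n} → (Fin n → Fin n) → ℕ → ℕ
ext σ zero = zero
ext {n} σ (suc j) with j <? n
... | yes p = suc (toℕ (σ (fromℕ< p)))
... | no _ = zero

extInv : ∀ {n} → (Fin n → Fin n) → ℕ → ℕ
extInv σ zero = zero
extInv {n} σ (suc j) with findFin (λ k → toℕ (σ k) ≡ᵇ j)
... | just k = suc (toℕ k)
... | nothing = zero

E : ∀ {n} → (Fin n → Fin n) → Fin n → ℕ
E σ i = suc (toℕ (σ i)) ∸ toℕ i

M : ∀ {n} → (Fin n → Fin n) → Fin n → ℕ
M σ i = ext σ (suc (extInv σ (toℕ i))) ∸ toℕ i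

Derangement : ∀ {n} → (Fin n → Fin n) → Set
Derangement σ = ∀ k → ¬ (σ k ≡ k)

NoSuccession : ∀ {n} → (Fin n → Fin n) → Set
NoSuccession {n} τ =
  (∀ (i : Fin n) → toℕ i ≡ 0 → ¬ (toℕ (τ i) ≡ 0)) ×'
  (∀ (i j : Fin n) → toℕ j ≡ suc (toℕ i) → ¬ (toℕ (τ j) ≡ suc (toℕ (τ i))))
  where open import Data.Product using () renaming (_×_ to _×'_)

{-# OPTIONS --safe #-}
-- Write τ = σζ, so that τ(k) = σ(k+1).  Ordering [n] by Π_τ lists every cycle
-- of τ as its maximum c̄ followed by τ⁻¹(c̄), τ⁻²(c̄), …, the cycles by increasing
-- maximum.  So an entry b of τ̂ is preceded by τ(b) unless b is a cycle maximum,
-- and the cycle maxima are exactly the left-to-right maxima of τ̂.  Reading τ̂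
-- backwards, in σ̄ each entry e is followed by τ(e) = σ(e+1) unless e is a cycle
-- maximum, and then both its follower and τ(e) are at most e: this is Eσ = Mσ̄,
-- and it makes a succession e, e+1 of σ̄ the same as a fixed point e+1 of σ,
-- while σ̄(1) = σ(1).  The left-to-right maxima give back the cycles, so τ̂
-- determines τ and σ ↦ σ̄ is injective on all of 𝔖ₙ; an injective self-map of
-- the finite set 𝔖ₙ is onto, and preimages of 𝒢ₙ are derangements.

module Submission where

open import Defs
open import Data.Nat using (ℕ; _≥_)
open import Data.Fin using (Fin)
open import Data.Fin.Permutation using (Permutation′; _⟨$⟩ʳ_)
open import Data.Product using (_×_; Σ-syntax)
open import Function.Definitions using (Injective)
open import Relation.Binary.PropositionalEquality using (_≡_; _≗_)

open import Data.Bool using (Bool; true; false; T; _∨_; _∧_)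
import Data.Bool as Bool
open import Data.Bool.Properties using (T-≡; T-∧; T-∨)
open import Data.Empty using (⊥; ⊥-elim)
open import Data.Fin using (zero; suc; toℕ; fromℕ; fromℕ<; inject₁; opposite; combine; funToFin; finToFun)
import Data.Fin.Properties as Finₚ
open Finₚ using (toℕ-injective; toℕ<n; toℕ-fromℕ; toℕ-fromℕ<; fromℕ<-toℕ; toℕ-inject₁;
                 funToFin-finToFin; finToFun-funToFin)
open import Data.Fin.Permutation using (permutation)
open import Data.List using ([]; _∷_; foldr; map; applyUpTo; allFin; length; filter)
import Data.List.Properties as List
open import Data.List.Membership.Propositional using (_∈_)
open import Data.List.Membership.Propositional.Properties using (∈-allFin; ∈-upTo⁺; ∈-upTo⁻)
open import Data.List.Relation.Unary.Any using (here; there)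
import Data.List.Relation.Unary.Any as Any
open import Data.Maybe using (just; fromMaybe)
import Data.Maybe as Maybe
open import Data.Nat using (zero; suc; _+_; _*_; _^_; _∸_; _⊔_; _≤_; _<_; z≤n; s≤s; s≤s⁻¹; z<s; _<ᵇ_; _≡ᵇ_; _<?_)
open import Data.Nat.DivMod using (_%_; _/_; m≡m%n+[m/n]*n; m%n<n)
open import Data.Nat.Properties
open import Data.Product using (_,_; proj₁; proj₂; ∃)
import Data.Product as Product
open import Data.Product.Relation.Binary.Lex.Strict using (×-Lex; ×-transitive; ×-compare)
open import Data.Sum using (_⊎_; inj₁; inj₂)
import Data.Sum as Sum
open import Function using (_∘_; id; _⇔_; mk⇔; Equivalence)
open import Function.Bundles using (Injection)
open import Function.Construct.Symmetry using (⇔-sym)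
open import Function.Properties.Inverse using (↔⇒↣)
open import Level using (Level; 0ℓ)
open import Relation.Binary using (Rel; IsStrictTotalOrder; Trichotomous; tri<; tri≈; tri>)
import Relation.Binary.Definitions as B
open import Relation.Binary.PropositionalEquality
  using (_≢_; refl; sym; trans; cong; cong₂; subst; subst₂; resp₂; isEquivalence; module ≡-Reasoning)
open import Relation.Binary.Structures.Biased using (isStrictTotalOrderᶜ)
open import Relation.Nullary using (¬_; Dec; yes; no; contradiction)
open import Relation.Nullary.Decidable using (map′; _→-dec_; decidable-stable)
import Relation.Unary as U

private variable
  ℓ : Level
  n : ℕ

-- Injective self-maps of Fin n

injective⇒surjective : {f : Fin n → Fin n} → Injective _≡_ _≡_ f → ∀ y → ∃ λ x → f x ≡ y
injective⇒surjective {n} {f} f-injective y with Finₚ.any? (λ x → f x Finₚ.≟ y)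
... | yes hit = hit
... | no miss = contradiction (Finₚ.injective⇒≤ g-injective) 1+n≰n
  where
  g : Fin (suc n) → Fin n
  g zero    = y
  g (suc i) = f i
  g-injective : Injective _≡_ _≡_ g
  g-injective {zero}  {zero}  _  = refl
  g-injective {zero}  {suc j} eq = contradiction (j , sym eq) miss
  g-injective {suc i} {zero}  eq = contradiction (i , eq) miss
  g-injective {suc i} {suc j} eq = cong suc (f-injective eq)

injective? : (f : Fin n → Fin n) → Dec (Injective _≡_ _≡_ f)
injective? f = map′ (λ inj {x} {y} → inj x y) (λ inj x y → inj)
  (Finₚ.all? λ x → Finₚ.all? λ y → (f x Finₚ.≟ f y) →-dec (x Finₚ.≟ y))

funToFin-cong : ∀ {k} {g h : Fin k → Fin n} → g ≗ h → funToFin g ≡ funToFin h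
funToFin-cong {k = zero}  _   = refl
funToFin-cong {k = suc k} g≗h = cong₂ combine (g≗h zero) (funToFin-cong (g≗h ∘ suc))

injective-resp-≗ : {g h : Fin n → Fin n} → g ≗ h → Injective _≡_ _≡_ g → Injective _≡_ _≡_ h
injective-resp-≗ g≗h g-injective eq = g-injective (trans (g≗h _) (trans eq (sym (g≗h _))))

module _ (Φ : (Fin n → Fin n) → Fin n → Fin n)
         (Φ-reflects-≗ : ∀ {g h} → Injective _≡_ _≡_ g → Injective _≡_ _≡_ h → Φ g ≗ Φ h → g ≗ h)
         (Φ-preserves-injective : ∀ {g} → Injective _≡_ _≡_ g → Injective _≡_ _≡_ (Φ g)) where

  private
    encode : (Fin n → Fin n) → Fin (n ^ n)
    encode = funToFin

    decode : Fin (n ^ n) → Fin n → Fin n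
    decode = finToFun

    decode-encode : ∀ {g c} → encode g ≡ c → decode c ≗ g
    decode-encode {g} refl = finToFun-funToFin g

    encode-decode : ∀ c → encode (decode c) ≡ c
    encode-decode = funToFin-finToFin {n} {n}

    -- Φ on codes of injections and the identity on all other codes: an injective
    -- self-map of the finite set Fin (n ^ n), hence onto.
    Ψ : Fin (n ^ n) → Fin (n ^ n)
    Ψ c with injective? (decode c)
    ... | yes _ = encode (Φ (decode c))
    ... | no _  = c

    Ψ-injective : Injective _≡_ _≡_ Ψ
    Ψ-injective {c} {c′} eq with injective? (decode c) | injective? (decode c′)
    ... | yes inj | yes inj′ = begin
      c                  ≡⟨ encode-decode c ⟨
      encode (decode c)  ≡⟨ funToFin-cong (Φ-reflects-≗ inj inj′ Φ≗) ⟩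
      encode (decode c′) ≡⟨ encode-decode c′ ⟩
      c′                 ∎
      where
      open ≡-Reasoning
      Φ≗ : Φ (decode c) ≗ Φ (decode c′)
      Φ≗ x = trans (sym (decode-encode eq x)) (decode-encode refl x)
    ... | yes inj | no ¬inj′ = ⊥-elim (¬inj′ (injective-resp-≗ (sym ∘ decode-encode eq) (Φ-preserves-injective inj)))
    ... | no ¬inj | yes inj′ = ⊥-elim (¬inj (injective-resp-≗ (sym ∘ decode-encode (sym eq)) (Φ-preserves-injective inj′)))
    ... | no _    | no _     = eq

  surjective-on-injections : ∀ {t} → Injective _≡_ _≡_ t → ∃ λ g → Injective _≡_ _≡_ g × Φ g ≗ t
  surjective-on-injections {t} t-injective with injective⇒surjective Ψ-injective (encode t)
  ... | c , Ψc≡t with injective? (decode c)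
  ...   | yes inj = decode c , inj , λ x → trans (sym (decode-encode refl x)) (decode-encode (sym Ψc≡t) x)
  ...   | no ¬inj = ⊥-elim (¬inj (injective-resp-≗ (sym ∘ decode-encode (sym Ψc≡t)) t-injective))

permutation-injective : (σ : Permutation′ n) → Injective _≡_ _≡_ (σ ⟨$⟩ʳ_)
permutation-injective σ = Injection.injective (↔⇒↣ σ)

injection⇒permutation : (g : Fin n → Fin n) → Injective _≡_ _≡_ g → Permutation′ n
injection⇒permutation g g-injective =
  permutation g (proj₁ ∘ onto) (proj₂ ∘ onto) (λ x → g-injective (proj₂ (onto (g x))))
  where onto = injective⇒surjective g-injective

findFin-unique : (p : Fin n → Bool) {k : Fin n} → (∀ {j} → T (p j) → j ≡ k) → T (p k) →
                 findFin p ≡ just k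
findFin-unique {suc n} p {k} unique pk with p zero in p0
... | true = cong just (unique (subst T (sym p0) _))
findFin-unique {suc n} p {zero}  unique pk | false = contradiction (subst T p0 pk) λ ()
findFin-unique {suc n} p {suc k} unique pk | false =
  cong (Maybe.map suc) (findFin-unique (p ∘ suc) (Finₚ.suc-injective ∘ unique) pk)

firstNat-sound : ∀ (P : ℕ → Bool) {b p} → T (P p) → p < b → T (P (firstNat b P)) × firstNat b P ≤ p
firstNat-sound P {suc b} {p} Pp p<b with P 0 in P0
... | true = subst T (sym P0) _ , z≤n
firstNat-sound P {suc b} {zero}  Pp p<b       | false = contradiction (subst T P0 Pp) λ ()
firstNat-sound P {suc b} {suc p} Pp (s≤s p<b) | false with firstNat-sound (P ∘ suc) Pp p<b
... | P-first , first≤p = P-first , s≤s first≤p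

firstNat-minimal : ∀ (P : ℕ → Bool) {b p} → p < firstNat b P → ¬ T (P p)
firstNat-minimal P {suc b} {p} p<first with P 0 in P0
firstNat-minimal P {suc b} {p}     ()          | true
firstNat-minimal P {suc b} {zero}  _           | false = subst T P0
firstNat-minimal P {suc b} {suc p} (s≤s p<first) | false = firstNat-minimal (P ∘ suc) {b} p<first

firstNat-unique : ∀ (P : ℕ → Bool) {b p} → T (P p) → (∀ {q} → q < p → ¬ T (P q)) → p < b →
                  firstNat b P ≡ p
firstNat-unique P Pp below p<b with firstNat-sound P Pp p<b
... | P-first , first≤p with m≤n⇒m<n∨m≡n first≤p
...   | inj₁ first<p = contradiction P-first (below first<p)
...   | inj₂ first≡p = first≡p

lexᵇ⇔ : ∀ {a b c d} → ((a <ᵇ b) ∨ ((a ≡ᵇ b) ∧ (c <ᵇ d))) ≡ true ⇔ ×-Lex _≡_ _<_ _<_ (a , c) (b , d)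
lexᵇ⇔ {a} {b} {c} {d} = mk⇔
  (Sum.map (<ᵇ⇒< a b) (Product.map (≡ᵇ⇒≡ a b) (<ᵇ⇒< c d) ∘ to T-∧) ∘ to T-∨ ∘ from T-≡)
  (to T-≡ ∘ from T-∨ ∘ Sum.map <⇒<ᵇ (from T-∧ ∘ Product.map (≡⇒≡ᵇ a b) <⇒<ᵇ))
  where open Equivalence

foldr⊔-upperBound : ∀ (g : ℕ → ℕ) {xs x} → x ∈ xs → g x ≤ foldr _⊔_ 0 (map g xs)
foldr⊔-upperBound g (here refl) = m≤m⊔n _ _
foldr⊔-upperBound g {y ∷ _} (there x∈xs) = ≤-trans (foldr⊔-upperBound g x∈xs) (m≤n⊔m (g y) _)

foldr⊔-attained : ∀ (g : ℕ → ℕ) y xs → ∃ λ x → x ∈ y ∷ xs × foldr _⊔_ 0 (map g (y ∷ xs)) ≡ g x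
foldr⊔-attained g y [] = y , here refl , ⊔-identityʳ (g y)
foldr⊔-attained g y (z ∷ zs) with foldr⊔-attained g z zs
... | x , x∈ , max≡gx with ⊔-sel (g y) (g x)
...   | inj₁ ≡gy = y , here refl    , trans (cong (g y ⊔_) max≡gx) ≡gy
...   | inj₂ ≡gx = x , there x∈ , trans (cong (g y ⊔_) max≡gx) ≡gx

module _ (g : Fin n → Fin n) where

  iter-shift : ∀ p k → iter g p (g k) ≡ iter g (suc p) k
  iter-shift zero    k = refl
  iter-shift (suc p) k = cong g (iter-shift p k)

  iter-+ : ∀ a b k → iter g (a + b) k ≡ iter g a (iter g b k)
  iter-+ zero    b k = refl
  iter-+ (suc a) b k = cong g (iter-+ a b k)

  iter-*-period : ∀ {P k} → iter g P k ≡ k → ∀ q → iter g (q * P) k ≡ k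
  iter-*-period cycle zero = refl
  iter-*-period {P} {k} cycle (suc q) =
    trans (iter-+ P (q * P) k) (trans (cong (iter g P) (iter-*-period cycle q)) cycle)

  iter-% : ∀ {P k} → iter g (suc P) k ≡ k → ∀ p → iter g p k ≡ iter g (p % suc P) k
  iter-% {P} {k} cycle p = begin
    iter g p k
      ≡⟨ cong (λ r → iter g r k) (m≡m%n+[m/n]*n p (suc P)) ⟩
    iter g (p % suc P + p / suc P * suc P) k
      ≡⟨ iter-+ (p % suc P) _ k ⟩
    iter g (p % suc P) (iter g (p / suc P * suc P) k)
      ≡⟨ cong (iter g (p % suc P)) (iter-*-period cycle (p / suc P)) ⟩
    iter g (p % suc P) k
      ∎
    where open ≡-Reasoning

  module _ (g-injective : Injective _≡_ _≡_ g) where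

    iter-injective : ∀ p {x y} → iter g p x ≡ iter g p y → x ≡ y
    iter-injective zero    eq = eq
    iter-injective (suc p) eq = iter-injective p (g-injective eq)

    iter-period : ∀ k → ∃ λ P → P < n × iter g (suc P) k ≡ k
    iter-period k with Finₚ.pigeonhole (n<1+n n) (λ (i : Fin (suc n)) → iter g (toℕ i) k)
    ... | i , j , i<j , same = P , P<n , iter-injective (toℕ i) (begin
        iter g (toℕ i) (iter g (suc P) k) ≡⟨ iter-+ (toℕ i) (suc P) k ⟨
        iter g (toℕ i + suc P) k          ≡⟨ cong (λ r → iter g r k) j≡i+1+P ⟨
        iter g (toℕ j) k                  ≡⟨ same ⟨
        iter g (toℕ i) k                  ∎)
      where
      open ≡-Reasoning
      P = toℕ j ∸ suc (toℕ i)
      j≡i+1+P : toℕ j ≡ toℕ i + suc P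
      j≡i+1+P = trans (sym (m+[n∸m]≡n i<j)) (sym (+-suc (toℕ i) P))
      P<n : P < n
      P<n = <-≤-trans (∸-monoʳ-< {o = 0} z<s i<j) (s≤s⁻¹ (toℕ<n j))

-- Ranking by a strict total order

module _ {a p q} {A : Set a} {P : A → Set p} {Q : A → Set q}
         (P? : U.Decidable P) (Q? : U.Decidable Q) (P⊆Q : ∀ {x} → P x → Q x) where

  length-filter-mono : ∀ xs → length (filter P? xs) ≤ length (filter Q? xs)
  length-filter-mono [] = z≤n
  length-filter-mono (x ∷ xs) with P? x | Q? x
  ... | yes _  | yes _  = s≤s (length-filter-mono xs)
  ... | yes px | no ¬qx = contradiction (P⊆Q px) ¬qx
  ... | no _   | yes _  = m≤n⇒m≤1+n (length-filter-mono xs)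
  ... | no _   | no _   = length-filter-mono xs

  length-filter-mono-< : ∀ {x} xs → x ∈ xs → Q x → ¬ P x →
                         length (filter P? xs) < length (filter Q? xs)
  length-filter-mono-< (y ∷ ys) (here refl) qy ¬py with P? y | Q? y
  ... | yes py | _      = contradiction py ¬py
  ... | no _   | yes _  = s≤s (length-filter-mono ys)
  ... | no _   | no ¬qy = contradiction qy ¬qy
  length-filter-mono-< (y ∷ ys) (there x∈ys) qx ¬px with P? y | Q? y
  ... | yes _  | yes _  = s≤s (length-filter-mono-< ys x∈ys qx ¬px)
  ... | yes py | no ¬qy = contradiction (P⊆Q py) ¬qy
  ... | no _   | yes _  = m≤n⇒m≤1+n (length-filter-mono-< ys x∈ys qx ¬px)
  ... | no _   | no _   = length-filter-mono-< ys x∈ys qx ¬px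

module CountingRank {_≺_ : Rel (Fin n) ℓ} (_≺?_ : B.Decidable _≺_) (≺-sto : IsStrictTotalOrder _≡_ _≺_) where

  open IsStrictTotalOrder ≺-sto using (irrefl; compare) renaming (trans to ≺-trans)

  rank≺ : Fin n → ℕ
  rank≺ k = length (filter (_≺? k) (allFin n))

  rank≺-mono-< : ∀ {a b} → a ≺ b → rank≺ a < rank≺ b
  rank≺-mono-< {a} {b} a≺b =
    length-filter-mono-< (_≺? a) (_≺? b) (λ c≺a → ≺-trans c≺a a≺b) (allFin n) (∈-allFin a) a≺b (irrefl refl)

  rank≺<n : ∀ k → rank≺ k < n
  rank≺<n k = subst (rank≺ k <_) (List.length-tabulate id)
    (List.filter-notAll (_≺? k) (allFin n) (Any.map (λ { refl → irrefl refl }) (∈-allFin k)))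

  rank≺-cancel-< : ∀ {a b} → rank≺ a < rank≺ b → a ≺ b
  rank≺-cancel-< {a} {b} ra<rb with compare a b
  ... | tri< a≺b _ _ = a≺b
  ... | tri≈ _ refl _ = contradiction ra<rb (<-irrefl refl)
  ... | tri> _ _ b≺a = contradiction ra<rb (<-asym (rank≺-mono-< b≺a))

  rank≺-injective : ∀ {a b} → rank≺ a ≡ rank≺ b → a ≡ b
  rank≺-injective {a} {b} ra≡rb with compare a b
  ... | tri< a≺b _ _ = contradiction ra≡rb (<⇒≢ (rank≺-mono-< a≺b))
  ... | tri≈ _ a≡b _ = a≡b
  ... | tri> _ _ b≺a = contradiction (sym ra≡rb) (<⇒≢ (rank≺-mono-< b≺a))

  rank≺-surjective : ∀ {r} → r < n → ∃ λ k → rank≺ k ≡ r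
  rank≺-surjective {r} r<n with injective⇒surjective toFin-injective (fromℕ< r<n)
    where
    toFin-injective : Injective _≡_ _≡_ (λ k → fromℕ< (rank≺<n k))
    toFin-injective {a} {b} eq = rank≺-injective (begin
      rank≺ a                 ≡⟨ toℕ-fromℕ< (rank≺<n a) ⟨
      toℕ (fromℕ< (rank≺<n a)) ≡⟨ cong toℕ eq ⟩
      toℕ (fromℕ< (rank≺<n b)) ≡⟨ toℕ-fromℕ< (rank≺<n b) ⟩
      rank≺ b                 ∎)
      where open ≡-Reasoning
  ... | k , eq = k , trans (sym (toℕ-fromℕ< (rank≺<n k))) (trans (cong toℕ eq) (toℕ-fromℕ< r<n))

  rank≺-cover : ∀ {a b} → a ≺ b → (∀ {c} → a ≺ c → c ≺ b → ⊥) → suc (rank≺ a) ≡ rank≺ b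
  rank≺-cover {a} {b} a≺b nothing-between = ≤-antisym (rank≺-mono-< a≺b) (≮⇒≥ no-gap)
    where
    no-gap : ¬ suc (rank≺ a) < rank≺ b
    no-gap gap with rank≺-surjective (<-trans gap (rank≺<n b))
    ... | c , rc≡ = nothing-between (rank≺-cancel-< (subst (rank≺ a <_) (sym rc≡) (n<1+n _)))
                                    (rank≺-cancel-< (subst (_< rank≺ b) (sym rc≡) gap))

LeftToRightMax : (Fin n → ℕ) → Fin n → Set
LeftToRightMax r b = ∀ a → r a < r b → toℕ a < toℕ b

LeftToRightMax-cong : ∀ {r r′ : Fin n → ℕ} {b} → r ≗ r′ → LeftToRightMax r b → LeftToRightMax r′ b
LeftToRightMax-cong {b = b} r≗r′ r-max a lt = r-max a (subst₂ _<_ (sym (r≗r′ a)) (sym (r≗r′ b)) lt)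

BlockEnd : (Fin n → ℕ) → (Fin n → Set ℓ) → Fin n → Fin n → Set ℓ
BlockEnd r Q c d = r c ≤ r d
                 × (∀ x → r c < r x → r x ≤ r d → ¬ Q x)
                 × (∀ e → r e ≡ suc (r d) → Q e)

BlockEnd-cong : ∀ {ℓ′} {r r′ : Fin n → ℕ} {Q : Fin n → Set ℓ} {Q′ : Fin n → Set ℓ′} {c d} →
                r ≗ r′ → (∀ {x} → Q x ⇔ Q′ x) → BlockEnd r Q c d → BlockEnd r′ Q′ c d
BlockEnd-cong {c = c} {d} r≗r′ Q⇔Q′ (c≤d , inside , next) =
  subst₂ _≤_ (r≗r′ c) (r≗r′ d) c≤d ,
  (λ x c<x x≤d → inside x (subst₂ _<_ (sym (r≗r′ c)) (sym (r≗r′ x)) c<x)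
                          (subst₂ _≤_ (sym (r≗r′ x)) (sym (r≗r′ d)) x≤d) ∘ Equivalence.from Q⇔Q′) ,
  (λ e e≡ → Equivalence.to Q⇔Q′ (next e (trans (r≗r′ e) (trans e≡ (cong suc (sym (r≗r′ d)))))))

module _ {r : Fin n → ℕ} (r<n : ∀ k → r k < n) (r-surjective : ∀ {v} → v < n → ∃ λ e → r e ≡ v)
         {Q : Fin n → Set ℓ} where

  private
    ends-before : ∀ {c d d′} → BlockEnd r Q c d → BlockEnd r Q c d′ → ¬ r d < r d′
    ends-before {c} {d} {d′} (c≤d , _ , next) (_ , inside′ , _) rd<rd′
      with r-surjective (≤-<-trans rd<rd′ (r<n d′))
    ... | e , re≡ = inside′ e (subst (r c <_) (sym re≡) (s≤s c≤d)) (subst (_≤ r d′) (sym re≡) rd<rd′)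
                      (next e re≡)

  blockEnd-unique : ∀ {c d d′} → BlockEnd r Q c d → BlockEnd r Q c d′ → r d ≡ r d′
  blockEnd-unique {d = d} {d′} end end′ with <-cmp (r d) (r d′)
  ... | tri< lt _ _ = contradiction lt (ends-before end end′)
  ... | tri≈ _ eq _ = eq
  ... | tri> _ _ gt = contradiction gt (ends-before end′ end)

-- Orbits of τ and the ranking by Π_τ

module OrbitOrder {m : ℕ} (τ : Fin (suc m) → Fin (suc m)) (τ-injective : Injective _≡_ _≡_ τ) where

  ReachesMax : Fin (suc m) → ℕ → Set
  ReachesMax k p = suc (toℕ (iter τ p k)) ≡ orbitMax τ k

  IsOrbitMax : Fin (suc m) → Set
  IsOrbitMax k = ReachesMax k 0

  isOrbitMax? : U.Decidable IsOrbitMax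
  isOrbitMax? k = suc (toℕ k) ≟ orbitMax τ k

  -- orbitMax only inspects the iterates p < n; the others repeat modulo the period.
  orbitMax-upperBound : ∀ p k → suc (toℕ (iter τ p k)) ≤ orbitMax τ k
  orbitMax-upperBound p k with iter-period τ τ-injective k
  ... | P , P<n , cycle = subst (λ x → suc (toℕ x) ≤ orbitMax τ k) (sym (iter-% τ cycle p))
        (foldr⊔-upperBound _ (∈-upTo⁺ (<-≤-trans (m%n<n p (suc P)) P<n)))

  orbitMax-attained : ∀ k → ∃ λ p → p < suc m × orbitMax τ k ≡ suc (toℕ (iter τ p k))
  orbitMax-attained k with foldr⊔-attained (λ p → suc (toℕ (iter τ p k))) 0 (applyUpTo suc m)
  ... | p , p∈ , max≡ = p , ∈-upTo⁻ p∈ , max≡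

  self<orbitMax : ∀ k → suc (toℕ k) ≤ orbitMax τ k
  self<orbitMax = orbitMax-upperBound 0

  orbitMax-iter-≤ : ∀ q k → orbitMax τ (iter τ q k) ≤ orbitMax τ k
  orbitMax-iter-≤ q k with orbitMax-attained (iter τ q k)
  ... | p , _ , max≡ = subst (_≤ orbitMax τ k) (sym (trans max≡ (cong (suc ∘ toℕ) (sym (iter-+ τ p q k)))))
                         (orbitMax-upperBound (p + q) k)

  orbitMax-τ : ∀ k → orbitMax τ (τ k) ≡ orbitMax τ k
  orbitMax-τ k with iter-period τ τ-injective k
  ... | P , _ , cycle = ≤-antisym (orbitMax-iter-≤ 1 k)
        (subst (λ x → orbitMax τ x ≤ orbitMax τ (τ k)) (trans (iter-shift τ P k) cycle)
               (orbitMax-iter-≤ P (τ k)))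

  orbitMax-iter : ∀ p k → orbitMax τ (iter τ p k) ≡ orbitMax τ k
  orbitMax-iter zero    k = refl
  orbitMax-iter (suc p) k = trans (orbitMax-τ (iter τ p k)) (orbitMax-iter p k)

  τ-orbitMax-≤ : ∀ {k} → IsOrbitMax k → toℕ (τ k) ≤ toℕ k
  τ-orbitMax-≤ {k} k-max =
    s≤s⁻¹ (subst (suc (toℕ (τ k)) ≤_) (trans (orbitMax-τ k) (sym k-max)) (self<orbitMax (τ k)))

  reachesMax-τ : ∀ {k p} → ReachesMax (τ k) p ⇔ ReachesMax k (suc p)
  reachesMax-τ {k} {p} = mk⇔
    (λ hit → trans (cong (suc ∘ toℕ) (sym (iter-shift τ p k))) (trans hit (orbitMax-τ k)))
    (λ hit → trans (cong (suc ∘ toℕ) (iter-shift τ p k)) (trans hit (sym (orbitMax-τ k))))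

  private
    reachesMaxᵇ : Fin (suc m) → ℕ → Bool
    reachesMaxᵇ k p = suc (toℕ (iter τ p k)) ≡ᵇ orbitMax τ k

  qIndex-reachesMax : ∀ k → ReachesMax k (qIndex τ k) × qIndex τ k < suc m
  qIndex-reachesMax k with orbitMax-attained k
  ... | p , p<n , max≡ with firstNat-sound (reachesMaxᵇ k) (≡⇒≡ᵇ _ _ (sym max≡)) p<n
  ...   | first-hit , first≤p = ≡ᵇ⇒≡ _ _ first-hit , ≤-<-trans first≤p p<n

  qIndex-minimal : ∀ {k p} → p < qIndex τ k → ¬ ReachesMax k p
  qIndex-minimal {k} p<q hit = firstNat-minimal (reachesMaxᵇ k) {suc m} p<q (≡⇒≡ᵇ _ _ hit)

  qIndex-unique : ∀ {k p} → ReachesMax k p → (∀ {q} → q < p → ¬ ReachesMax k q) → p < suc m → qIndex τ k ≡ p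
  qIndex-unique {k} hit below = firstNat-unique (reachesMaxᵇ k) (≡⇒≡ᵇ _ _ hit) (λ q<p → below q<p ∘ ≡ᵇ⇒≡ _ _)

  IsOrbitMax⇒qIndex≡0 : ∀ {k} → IsOrbitMax k → qIndex τ k ≡ 0
  IsOrbitMax⇒qIndex≡0 k-max = qIndex-unique k-max (λ ()) z<s

  qIndex≡0⇒IsOrbitMax : ∀ {k} → qIndex τ k ≡ 0 → IsOrbitMax k
  qIndex≡0⇒IsOrbitMax {k} q≡0 = subst (ReachesMax k) q≡0 (proj₁ (qIndex-reachesMax k))

  qIndex-τ : ∀ {k} → ¬ IsOrbitMax k → suc (qIndex τ (τ k)) ≡ qIndex τ k
  qIndex-τ {k} ¬max with qIndex τ k in q≡ | qIndex-reachesMax k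
  ... | zero  | _ = contradiction (qIndex≡0⇒IsOrbitMax q≡) ¬max
  ... | suc r | hit , 1+r<n = cong suc (qIndex-unique (Equivalence.from (reachesMax-τ {k} {r}) hit)
        (λ {q} q<r → qIndex-minimal (subst (suc q <_) (sym q≡) (s≤s q<r))
                   ∘ Equivalence.to (reachesMax-τ {k} {q}))
        (<-trans (n<1+n r) 1+r<n))

  key : Fin (suc m) → ℕ × ℕ
  key k = orbitMax τ k , qIndex τ k

  key-injective : ∀ {a b} → orbitMax τ a ≡ orbitMax τ b → qIndex τ a ≡ qIndex τ b → a ≡ b
  key-injective {a} {b} max≡ q≡ = iter-injective τ τ-injective (qIndex τ a)
    (toℕ-injective (suc-injective (trans a-reaches (trans max≡ (sym b-reaches)))))
    where
    a-reaches : ReachesMax a (qIndex τ a)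
    a-reaches = proj₁ (qIndex-reachesMax a)
    b-reaches : ReachesMax b (qIndex τ a)
    b-reaches = subst (ReachesMax b) (sym q≡) (proj₁ (qIndex-reachesMax b))

  _⊏_ : Rel (Fin (suc m)) 0ℓ
  a ⊏ b = ×-Lex _≡_ _<_ _<_ (key a) (key b)

  _≺_ : Rel (Fin (suc m)) 0ℓ
  a ≺ b = ΠLess τ a b ≡ true

  ≺⇔⊏ : ∀ {a b} → a ≺ b ⇔ a ⊏ b
  ≺⇔⊏ = lexᵇ⇔

  private
    open Equivalence using (to; from)

    ⊏-trans : ∀ {a b c} → a ⊏ b → b ⊏ c → a ⊏ c
    ⊏-trans = ×-transitive {_≈₁_ = _≡_} {_<₁_ = _<_} {_<₂_ = _<_} isEquivalence (resp₂ _<_) <-trans <-trans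

    ≺-compare : Trichotomous _≡_ _≺_
    ≺-compare a b with ×-compare sym <-cmp <-cmp (key a) (key b)
    ... | tri< a⊏b ≢ b⋢a = tri< (from ≺⇔⊏ a⊏b) (≢ ∘ λ { refl → refl , refl }) (b⋢a ∘ to ≺⇔⊏)
    ... | tri≈ a⋢b (max≡ , q≡) b⋢a = tri≈ (a⋢b ∘ to ≺⇔⊏) (key-injective max≡ q≡) (b⋢a ∘ to ≺⇔⊏)
    ... | tri> a⋢b ≢ b⊏a = tri> (a⋢b ∘ to ≺⇔⊏) (≢ ∘ λ { refl → refl , refl }) (from ≺⇔⊏ b⊏a)

  ≺-isStrictTotalOrder : IsStrictTotalOrder _≡_ _≺_
  ≺-isStrictTotalOrder = isStrictTotalOrderᶜ record
    { isEquivalence = isEquivalence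
    ; trans         = λ a≺b b≺c → from ≺⇔⊏ (⊏-trans (to ≺⇔⊏ a≺b) (to ≺⇔⊏ b≺c))
    ; compare       = ≺-compare
    }

  private
    module Rank = CountingRank (λ a b → ΠLess τ a b Bool.≟ true) ≺-isStrictTotalOrder

  rank-mono-< : ∀ {a b} → a ≺ b → rank τ a < rank τ b
  rank-mono-< = Rank.rank≺-mono-<

  rank-cancel-< : ∀ {a b} → rank τ a < rank τ b → a ≺ b
  rank-cancel-< = Rank.rank≺-cancel-<

  rank<n : ∀ k → rank τ k < suc m
  rank<n = Rank.rank≺<n

  rank-injective : ∀ {a b} → rank τ a ≡ rank τ b → a ≡ b
  rank-injective = Rank.rank≺-injective

  rank-surjective : ∀ {r} → r < suc m → ∃ λ k → rank τ k ≡ r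
  rank-surjective = Rank.rank≺-surjective

  rank-cover : ∀ {a b} → a ≺ b → (∀ {c} → a ≺ c → c ≺ b → ⊥) → suc (rank τ a) ≡ rank τ b
  rank-cover = Rank.rank≺-cover

  private
    ⊏⇒orbitMax≤ : ∀ {a b} → a ⊏ b → orbitMax τ a ≤ orbitMax τ b
    ⊏⇒orbitMax≤ (inj₁ lt)       = <⇒≤ lt
    ⊏⇒orbitMax≤ (inj₂ (eq , _)) = ≤-reflexive eq

    ⊏⇒qIndex< : ∀ {a b} → a ⊏ b → orbitMax τ a ≡ orbitMax τ b → qIndex τ a < qIndex τ b
    ⊏⇒qIndex< (inj₁ lt)       eq = contradiction eq (<⇒≢ lt)
    ⊏⇒qIndex< (inj₂ (_ , lt)) _  = lt

    ⊏-orbitMax : ∀ {a b} → IsOrbitMax b → a ⊏ b → orbitMax τ a < orbitMax τ b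
    ⊏-orbitMax b-max (inj₁ lt)       = lt
    ⊏-orbitMax b-max (inj₂ (_ , lt)) = contradiction (subst (_ <_) (IsOrbitMax⇒qIndex≡0 b-max) lt) λ ()

    rank<⇒⊏ : ∀ {a b} → rank τ a < rank τ b → a ⊏ b
    rank<⇒⊏ = to ≺⇔⊏ ∘ rank-cancel-<

  rank≤⇒orbitMax≤ : ∀ {a b} → rank τ a ≤ rank τ b → orbitMax τ a ≤ orbitMax τ b
  rank≤⇒orbitMax≤ ra≤rb with m≤n⇒m<n∨m≡n ra≤rb
  ... | inj₁ lt = ⊏⇒orbitMax≤ (rank<⇒⊏ lt)
  ... | inj₂ eq = ≤-reflexive (cong (orbitMax τ) (rank-injective eq))

  rank-τ : ∀ {b} → ¬ IsOrbitMax b → suc (rank τ (τ b)) ≡ rank τ b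
  rank-τ {b} ¬max = rank-cover (from ≺⇔⊏ τb⊏b) λ τb≺c c≺b → between (to ≺⇔⊏ τb≺c) (to ≺⇔⊏ c≺b)
    where
    τb⊏b : τ b ⊏ b
    τb⊏b = inj₂ (orbitMax-τ b , ≤-reflexive (qIndex-τ ¬max))
    between : ∀ {c} → τ b ⊏ c → c ⊏ b → ⊥
    between {c} τb⊏c c⊏b = <-irrefl refl (<-≤-trans (⊏⇒qIndex< c⊏b max≡)
      (subst (_≤ qIndex τ c) (qIndex-τ ¬max) (⊏⇒qIndex< τb⊏c (trans (orbitMax-τ b) (sym max≡)))))
      where
      max≡ : orbitMax τ c ≡ orbitMax τ b
      max≡ = ≤-antisym (⊏⇒orbitMax≤ c⊏b) (subst (_≤ orbitMax τ c) (orbitMax-τ b) (⊏⇒orbitMax≤ τb⊏c))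

  IsOrbitMax⇒LeftToRightMax : ∀ {b} → IsOrbitMax b → LeftToRightMax (rank τ) b
  IsOrbitMax⇒LeftToRightMax {b} b-max a ra<rb = s≤s⁻¹ (≤-<-trans (self<orbitMax a)
    (subst (orbitMax τ a <_) (sym b-max) (⊏-orbitMax b-max (rank<⇒⊏ ra<rb))))

  LeftToRightMax⇒IsOrbitMax : ∀ {b} → LeftToRightMax (rank τ) b → IsOrbitMax b
  LeftToRightMax⇒IsOrbitMax {b} b-ltr = decidable-stable (isOrbitMax? b) not-max
    where
    not-max : ¬ ¬ IsOrbitMax b
    not-max ¬max with orbitMax-attained b
    ... | p , _ , max≡ = <⇒≱ (b-ltr top (rank-mono-< (from ≺⇔⊏ top⊏b)))
                               (s≤s⁻¹ (subst (suc (toℕ b) ≤_) max≡ (self<orbitMax b)))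
      where
      top = iter τ p b
      top-max : IsOrbitMax top
      top-max = trans (sym max≡) (sym (orbitMax-iter p b))
      top⊏b : top ⊏ b
      top⊏b = inj₂ (orbitMax-iter p b , subst (_< qIndex τ b) (sym (IsOrbitMax⇒qIndex≡0 top-max))
                                                (n≢0⇒n>0 (¬max ∘ qIndex≡0⇒IsOrbitMax)))

  blockEnd-τ : ∀ {c} → IsOrbitMax c → BlockEnd (rank τ) IsOrbitMax c (τ c)
  blockEnd-τ {c} c-max = c≤τc , no-max-inside , max-after
    where
    c≤τc : rank τ c ≤ rank τ (τ c)
    c≤τc = ≮⇒≥ λ lt → <⇒≢ (⊏-orbitMax c-max (rank<⇒⊏ lt)) (orbitMax-τ c)
    no-max-inside : ∀ x → rank τ c < rank τ x → rank τ x ≤ rank τ (τ c) → ¬ IsOrbitMax x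
    no-max-inside x c<x x≤τc x-max = <-irrefl (cong (rank τ) c≡x) c<x
      where
      c≡x : c ≡ x
      c≡x = toℕ-injective (suc-injective (trans c-max (trans (≤-antisym (rank≤⇒orbitMax≤ (<⇒≤ c<x))
              (subst (orbitMax τ x ≤_) (orbitMax-τ c) (rank≤⇒orbitMax≤ x≤τc))) (sym x-max))))
    max-after : ∀ e → rank τ e ≡ suc (rank τ (τ c)) → IsOrbitMax e
    max-after e e≡ = decidable-stable (isOrbitMax? e) λ ¬max →
      1+n≰n (subst (_≤ rank τ (τ c)) (trans (cong (rank τ) (sym (e≡c ¬max))) e≡) c≤τc)
      where
      e≡c : ¬ IsOrbitMax e → e ≡ c
      e≡c ¬max = τ-injective (rank-injective (suc-injective (trans (rank-τ ¬max) e≡)))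

  rank-consecutive : ∀ {a b} → suc (rank τ a) ≡ rank τ b →
                     (¬ IsOrbitMax b × a ≡ τ b) ⊎ (IsOrbitMax b × toℕ a < toℕ b)
  rank-consecutive {a} {b} a+1≡b with isOrbitMax? b
  ... | no ¬max  = inj₁ (¬max , rank-injective (suc-injective (trans a+1≡b (sym (rank-τ ¬max)))))
  ... | yes bmax = inj₂ (bmax , IsOrbitMax⇒LeftToRightMax bmax a (≤-reflexive a+1≡b))

  rank≡0⇒IsOrbitMax : ∀ {b} → rank τ b ≡ 0 → IsOrbitMax b
  rank≡0⇒IsOrbitMax {b} rb≡0 =
    decidable-stable (isOrbitMax? b) λ ¬max → contradiction (trans (rank-τ ¬max) rb≡0) λ ()

  hat-spec : ∀ {i k} → rank τ k ≡ toℕ i → hat τ i ≡ k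
  hat-spec {i} {k} rk≡i = cong (fromMaybe i) (findFin-unique (λ j → rank τ j ≡ᵇ toℕ i)
    (λ {j} hit → rank-injective (trans (≡ᵇ⇒≡ (rank τ j) (toℕ i) hit) (sym rk≡i))) (≡⇒≡ᵇ (rank τ k) (toℕ i) rk≡i))

  rank-hat : ∀ i → rank τ (hat τ i) ≡ toℕ i
  rank-hat i = subst (λ x → rank τ x ≡ toℕ i) (sym (hat-spec {i} {k} rk≡i)) rk≡i
    where
    k : Fin (suc m)
    k = proj₁ (rank-surjective (toℕ<n i))
    rk≡i : rank τ k ≡ toℕ i
    rk≡i = proj₂ (rank-surjective (toℕ<n i))

  hat-rank : ∀ k → hat τ (fromℕ< (rank<n k)) ≡ k
  hat-rank k = hat-spec {fromℕ< (rank<n k)} {k} (sym (toℕ-fromℕ< (rank<n k)))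

  hat-last : hat τ (fromℕ m) ≡ τ (fromℕ m)
  hat-last with injective⇒surjective τ-injective (hat τ (fromℕ m))
  ... | c , τc≡last = trans (sym τc≡last) (cong τ c≡last)
    where
    rank-τc : rank τ (τ c) ≡ m
    rank-τc = trans (cong (rank τ) τc≡last) (trans (rank-hat (fromℕ m)) (toℕ-fromℕ m))
    c-max : IsOrbitMax c
    c-max = decidable-stable (isOrbitMax? c) λ ¬max →
      <-irrefl (trans (sym (rank-τ ¬max)) (cong suc rank-τc)) (rank<n c)
    m≤c : m ≤ toℕ c
    m≤c = s≤s⁻¹ (begin
      suc m                   ≡⟨ cong suc (toℕ-fromℕ m) ⟨
      suc (toℕ (fromℕ m))     ≤⟨ self<orbitMax (fromℕ m) ⟩
      orbitMax τ (fromℕ m)    ≤⟨ rank≤⇒orbitMax≤ (subst (rank τ (fromℕ m) ≤_) (sym rank-τc)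
                                                          (s≤s⁻¹ (rank<n (fromℕ m)))) ⟩
      orbitMax τ (τ c)        ≡⟨ orbitMax-τ c ⟩
      orbitMax τ c            ≡⟨ c-max ⟨
      suc (toℕ c)             ∎)
      where open ≤-Reasoning
    c≡last : c ≡ fromℕ m
    c≡last = toℕ-injective (trans (≤-antisym (s≤s⁻¹ (toℕ<n c)) m≤c) (sym (toℕ-fromℕ m)))

-- The ranking recovers the cycle maxima as its left-to-right maxima, τ elsewhere by
-- rank-τ, and τ of a maximum as the end of its block.
hat-reflects-≗ : ∀ {m} {τ τ′ : Fin (suc m) → Fin (suc m)} →
                 Injective _≡_ _≡_ τ → Injective _≡_ _≡_ τ′ → hat τ ≗ hat τ′ → τ ≗ τ′
hat-reflects-≗ {τ = τ} {τ′} τ-injective τ′-injective hat≗ c = τc≡τ′c (O.isOrbitMax? c)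
  where
  module O  = OrbitOrder τ τ-injective
  module O′ = OrbitOrder τ′ τ′-injective
  open ≡-Reasoning

  rank≗ : rank τ ≗ rank τ′
  rank≗ k = begin
    rank τ k          ≡⟨ toℕ-fromℕ< (O.rank<n k) ⟨
    toℕ i             ≡⟨ O′.rank-hat i ⟨
    rank τ′ (hat τ′ i) ≡⟨ cong (rank τ′) (hat≗ i) ⟨
    rank τ′ (hat τ i)  ≡⟨ cong (rank τ′) (O.hat-rank k) ⟩
    rank τ′ k         ∎
    where i = fromℕ< (O.rank<n k)

  max⇔ : ∀ {x} → O.IsOrbitMax x ⇔ O′.IsOrbitMax x
  max⇔ = mk⇔ (O′.LeftToRightMax⇒IsOrbitMax ∘ LeftToRightMax-cong rank≗ ∘ O.IsOrbitMax⇒LeftToRightMax)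
             (O.LeftToRightMax⇒IsOrbitMax ∘ LeftToRightMax-cong (sym ∘ rank≗) ∘ O′.IsOrbitMax⇒LeftToRightMax)

  τc≡τ′c : Dec (O.IsOrbitMax c) → τ c ≡ τ′ c
  τc≡τ′c (no ¬max) = O.rank-injective (suc-injective (begin
    suc (rank τ (τ c))   ≡⟨ O.rank-τ ¬max ⟩
    rank τ c             ≡⟨ rank≗ c ⟩
    rank τ′ c            ≡⟨ O′.rank-τ (¬max ∘ Equivalence.from max⇔) ⟨
    suc (rank τ′ (τ′ c)) ≡⟨ cong suc (rank≗ (τ′ c)) ⟨
    suc (rank τ (τ′ c))  ∎))
  τc≡τ′c (yes c-max) = O.rank-injective (blockEnd-unique O.rank<n O.rank-surjective (O.blockEnd-τ c-max)
    (BlockEnd-cong (sym ∘ rank≗) (⇔-sym max⇔) (O′.blockEnd-τ (Equivalence.to max⇔ c-max))))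

-- The map σ ↦ σ̄

data LastOrInject₁ {m : ℕ} : Fin (suc m) → Set where
  isLast    : LastOrInject₁ (fromℕ m)
  isInject₁ : (i : Fin m) → LastOrInject₁ (inject₁ i)

lastOrInject₁ : ∀ {m} (k : Fin (suc m)) → LastOrInject₁ k
lastOrInject₁ {zero}  zero    = isLast
lastOrInject₁ {suc m} zero    = isInject₁ zero
lastOrInject₁ {suc m} (suc k) with lastOrInject₁ k
... | isLast      = isLast
... | isInject₁ i = isInject₁ (suc i)

ζ-last : ∀ {m} → ζ (fromℕ m) ≡ zero
ζ-last {m} with suc (toℕ (fromℕ m)) <? suc m
... | yes lt = contradiction (subst (λ x → suc x < suc m) (toℕ-fromℕ m) lt) (<-irrefl refl)
... | no _   = refl

ζ-inject₁ : ∀ {m} (i : Fin m) → ζ (inject₁ i) ≡ suc i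
ζ-inject₁ {m} i with suc (toℕ (inject₁ i)) <? suc m
... | yes lt = toℕ-injective (trans (toℕ-fromℕ< lt) (cong suc (toℕ-inject₁ i)))
... | no ≮   = contradiction (subst (λ x → suc x < suc m) (sym (toℕ-inject₁ i)) (toℕ<n (suc i))) ≮

ζ-injective : ∀ {m} → Injective _≡_ _≡_ (ζ {suc m})
ζ-injective {x = x} {y} eq with lastOrInject₁ x | lastOrInject₁ y
... | isLast      | isLast      = refl
... | isLast      | isInject₁ j = contradiction (trans (sym ζ-last) (trans eq (ζ-inject₁ j))) λ ()
... | isInject₁ i | isLast      = contradiction (trans (sym (ζ-inject₁ i)) (trans eq ζ-last)) λ ()
... | isInject₁ i | isInject₁ j =
  cong inject₁ (Finₚ.suc-injective (trans (sym (ζ-inject₁ i)) (trans eq (ζ-inject₁ j))))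

ζ-surjective : ∀ {m} (k : Fin (suc m)) → ∃ λ j → ζ j ≡ k
ζ-surjective zero    = fromℕ _ , ζ-last
ζ-surjective (suc i) = inject₁ i , ζ-inject₁ i

ζ-suc : ∀ {m} {k k′ : Fin (suc m)} → toℕ k′ ≡ suc (toℕ k) → ζ k ≡ k′
ζ-suc {m} {k} {k′} k′≡1+k with lastOrInject₁ k
... | isLast = contradiction (subst (λ x → suc x < suc m) (toℕ-fromℕ m) (subst (_< suc m) k′≡1+k (toℕ<n k′)))
                             (<-irrefl refl)
... | isInject₁ i = trans (ζ-inject₁ i) (toℕ-injective (trans (cong suc (sym (toℕ-inject₁ i))) (sym k′≡1+k)))

ext-toℕ : (g : Fin n → Fin n) (x : Fin n) → ext g (suc (toℕ x)) ≡ suc (toℕ (g x))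
ext-toℕ {n} g x with toℕ x <? n
... | yes lt = cong (λ y → suc (toℕ (g y))) (fromℕ<-toℕ x lt)
... | no ≮   = contradiction (toℕ<n x) ≮

ext-beyond : (g : Fin n → Fin n) → ext g (suc n) ≡ 0
ext-beyond {n} g with n <? n
... | yes lt = contradiction lt (<-irrefl refl)
... | no _   = refl

extInv-toℕ : {g : Fin n → Fin n} → Injective _≡_ _≡_ g → ∀ x → extInv g (suc (toℕ (g x))) ≡ suc (toℕ x)
extInv-toℕ {g = g} g-injective x
  rewrite findFin-unique (λ k → toℕ (g k) ≡ᵇ toℕ (g x)) (λ hit → g-injective (toℕ-injective (≡ᵇ⇒≡ _ _ hit)))
                         (≡⇒≡ᵇ (toℕ (g x)) _ refl) = refl

module Bar {m : ℕ} (f : Fin (suc m) → Fin (suc m)) (f-injective : Injective _≡_ _≡_ f) where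

  τ : Fin (suc m) → Fin (suc m)
  τ = f ∘ ζ

  open OrbitOrder τ (ζ-injective ∘ f-injective)

  bar-rank : ∀ j → rank τ (bar f j) ≡ m ∸ toℕ j
  bar-rank j = trans (rank-hat (opposite j)) (Finₚ.opposite-prop j)

  bar-injective : Injective _≡_ _≡_ (bar f)
  bar-injective {a} {b} eq = toℕ-injective (∸-cancelˡ-≡ (s≤s⁻¹ (toℕ<n a)) (s≤s⁻¹ (toℕ<n b))
    (trans (sym (bar-rank a)) (trans (cong (rank τ) eq) (bar-rank b))))

  bar-zero : bar f zero ≡ f zero
  bar-zero = trans hat-last (cong f ζ-last)

  position : Fin (suc m) → Fin (suc m)
  position e = opposite (fromℕ< (rank<n e))

  bar-position : ∀ e → bar f (position e) ≡ e
  bar-position e = trans (cong (hat τ) (Finₚ.opposite-involutive (fromℕ< (rank<n e)))) (hat-rank e)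

  private
    suc[m∸1+r]≡m∸r : ∀ {r} → suc r ≤ m → suc (m ∸ suc r) ≡ m ∸ r
    suc[m∸1+r]≡m∸r 1+r≤m = sym (+-∸-assoc 1 1+r≤m)

  bar-rank-adjacent : ∀ {i j} → toℕ j ≡ suc (toℕ i) → suc (rank τ (bar f j)) ≡ rank τ (bar f i)
  bar-rank-adjacent {i} {j} j≡1+i = begin
    suc (rank τ (bar f j)) ≡⟨ cong suc (trans (bar-rank j) (cong (m ∸_) j≡1+i)) ⟩
    suc (m ∸ suc (toℕ i))  ≡⟨ suc[m∸1+r]≡m∸r (subst (_≤ m) j≡1+i (s≤s⁻¹ (toℕ<n j))) ⟩
    m ∸ toℕ i              ≡⟨ bar-rank i ⟨
    rank τ (bar f i)       ∎
    where open ≡-Reasoning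

  position-adjacent : ∀ {a b} → suc (rank τ a) ≡ rank τ b → toℕ (position a) ≡ suc (toℕ (position b))
  position-adjacent {a} {b} a+1≡b = begin
    toℕ (position a)          ≡⟨ toℕ-position a ⟩
    m ∸ rank τ a              ≡⟨ suc[m∸1+r]≡m∸r {rank τ a} (subst (_≤ m) (sym a+1≡b) (s≤s⁻¹ (rank<n b))) ⟨
    suc (m ∸ suc (rank τ a))  ≡⟨ cong (λ r → suc (m ∸ r)) a+1≡b ⟩
    suc (m ∸ rank τ b)        ≡⟨ cong suc (toℕ-position b) ⟨
    suc (toℕ (position b))    ∎
    where
    open ≡-Reasoning
    toℕ-position : ∀ e → toℕ (position e) ≡ m ∸ rank τ e
    toℕ-position e = trans (Finₚ.opposite-prop (fromℕ< (rank<n e))) (cong (m ∸_) (toℕ-fromℕ< (rank<n e)))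

  succession⇒fixedPoint : ∀ {i j} → toℕ j ≡ suc (toℕ i) → toℕ (bar f j) ≡ suc (toℕ (bar f i)) →
                          f (bar f j) ≡ bar f j
  succession⇒fixedPoint {i} {j} adjacent succession =
    fixed (rank-consecutive {bar f j} {bar f i} (bar-rank-adjacent adjacent))
    where
    fixed : (¬ IsOrbitMax (bar f i) × bar f j ≡ τ (bar f i))
          ⊎ (IsOrbitMax (bar f i) × toℕ (bar f j) < toℕ (bar f i)) →
            f (bar f j) ≡ bar f j
    fixed (inj₁ (_ , a≡τb)) = trans (cong f (sym (ζ-suc succession))) (sym a≡τb)
    fixed (inj₂ (_ , a<b))  = contradiction a<b (<-asym (subst (toℕ (bar f i) <_) (sym succession) (n<1+n _)))

  bar-noSuccession : Derangement f → NoSuccession (bar f)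
  bar-noSuccession derangement = at-start , later
    where
    at-start : ∀ i → toℕ i ≡ 0 → toℕ (bar f i) ≢ 0
    at-start zero _ bar0≡0 = derangement zero (trans (sym bar-zero) (toℕ-injective bar0≡0))
    later : ∀ i j → toℕ j ≡ suc (toℕ i) → toℕ (bar f j) ≢ suc (toℕ (bar f i))
    later i j adjacent succession = derangement (bar f j) (succession⇒fixedPoint adjacent succession)

  noSuccession⇒derangement : NoSuccession (bar f) → Derangement f
  noSuccession⇒derangement (at-start , _) zero f0≡0 = at-start zero refl (cong toℕ (trans bar-zero f0≡0))
  noSuccession⇒derangement (_ , later) (suc k) fixed =
    later (position e) (position (suc k)) (position-adjacent rank-step)
      (trans (cong toℕ (bar-position (suc k))) (cong suc (trans (sym (toℕ-inject₁ k)) (cong toℕ (sym (bar-position e))))))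
    where
    e = inject₁ k
    τe≡1+k : τ e ≡ suc k
    τe≡1+k = trans (cong f (ζ-inject₁ k)) fixed
    e-not-max : ¬ IsOrbitMax e
    e-not-max e-max = 1+n≰n (subst (suc (toℕ k) ≤_) (toℕ-inject₁ k)
                                   (subst (_≤ toℕ e) (cong toℕ τe≡1+k) (τ-orbitMax-≤ e-max)))
    rank-step : suc (rank τ (suc k)) ≡ rank τ e
    rank-step = subst (λ x → suc (rank τ x) ≡ rank τ e) τe≡1+k (rank-τ e-not-max)

  private
    follower-gap : ∀ {a b} → suc (rank τ a) ≡ rank τ b →
                   suc (toℕ a) ∸ suc (toℕ b) ≡ suc (toℕ (τ b)) ∸ suc (toℕ b)
    follower-gap {a} {b} a+1≡b = gap (rank-consecutive {a} {b} a+1≡b)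
      where
      gap : (¬ IsOrbitMax b × a ≡ τ b) ⊎ (IsOrbitMax b × toℕ a < toℕ b) →
            suc (toℕ a) ∸ suc (toℕ b) ≡ suc (toℕ (τ b)) ∸ suc (toℕ b)
      gap (inj₁ (_ , a≡τb))    = cong (λ z → suc (toℕ z) ∸ suc (toℕ b)) a≡τb
      gap (inj₂ (b-max , a<b)) = trans (m≤n⇒m∸n≡0 (<⇒≤ a<b)) (sym (m≤n⇒m∸n≡0 (τ-orbitMax-≤ b-max)))

    next-gap : ∀ x → LastOrInject₁ x → ext (bar f) (suc (suc (toℕ x))) ∸ suc (toℕ (bar f x))
                                       ≡ suc (toℕ (τ (bar f x))) ∸ suc (toℕ (bar f x))
    next-gap _ isLast = begin
      ext (bar f) (suc (suc (toℕ (fromℕ m)))) ∸ suc (toℕ last)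
        ≡⟨ cong (λ y → ext (bar f) (suc (suc y)) ∸ suc (toℕ last)) (toℕ-fromℕ m) ⟩
      ext (bar f) (suc (suc m)) ∸ suc (toℕ last)
        ≡⟨ cong (_∸ suc (toℕ last)) (ext-beyond (bar f)) ⟩
      0
        ≡⟨ m≤n⇒m∸n≡0 (τ-orbitMax-≤ last-max) ⟨
      suc (toℕ (τ last)) ∸ suc (toℕ last)
        ∎
      where
      open ≡-Reasoning
      last = bar f (fromℕ m)
      last-max : IsOrbitMax last
      last-max = rank≡0⇒IsOrbitMax (trans (bar-rank (fromℕ m)) (trans (cong (m ∸_) (toℕ-fromℕ m)) (n∸n≡0 m)))
    next-gap _ (isInject₁ y) =
      trans (cong (_∸ suc (toℕ (bar f (inject₁ y)))) next) (follower-gap (bar-rank-adjacent adjacent))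
      where
      adjacent : toℕ (suc y) ≡ suc (toℕ (inject₁ y))
      adjacent = cong suc (sym (toℕ-inject₁ y))
      next : ext (bar f) (suc (suc (toℕ (inject₁ y)))) ≡ suc (toℕ (bar f (suc y)))
      next = trans (cong (ext (bar f) ∘ suc) (sym adjacent)) (ext-toℕ (bar f) (suc y))

  E≗M : E f ≗ M (bar f)
  E≗M zero = sym (trans (ext-toℕ (bar f) zero) (cong (suc ∘ toℕ) bar-zero))
  E≗M (suc k) = begin
    suc (toℕ (f (suc k))) ∸ suc (toℕ k)
      ≡⟨ cong₂ (λ y z → suc (toℕ (f y)) ∸ suc z) (sym (ζ-inject₁ k)) (sym (toℕ-inject₁ k)) ⟩
    suc (toℕ (τ e)) ∸ suc (toℕ e)
      ≡⟨ cong (λ y → suc (toℕ (τ y)) ∸ suc (toℕ y)) (sym (bar-position e)) ⟩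
    suc (toℕ (τ (bar f x))) ∸ suc (toℕ (bar f x))
      ≡⟨ next-gap x (lastOrInject₁ x) ⟨
    ext (bar f) (suc (suc (toℕ x))) ∸ suc (toℕ (bar f x))
      ≡⟨ cong₂ (λ y z → ext (bar f) (suc y) ∸ suc z) (sym (extInv-toℕ bar-injective x)) value≡k ⟩
    ext (bar f) (suc (extInv (bar f) (suc (toℕ (bar f x))))) ∸ suc (toℕ k)
      ≡⟨ cong (λ y → ext (bar f) (suc (extInv (bar f) (suc y))) ∸ suc (toℕ k)) value≡k ⟩
    ext (bar f) (suc (extInv (bar f) (suc (toℕ k)))) ∸ suc (toℕ k) ∎
    where
    open ≡-Reasoning
    e = inject₁ k
    x = position e
    value≡k : toℕ (bar f x) ≡ toℕ k
    value≡k = trans (cong toℕ (bar-position e)) (toℕ-inject₁ k)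

bar-reflects-≗ : ∀ {m} {f f′ : Fin (suc m) → Fin (suc m)} →
                 Injective _≡_ _≡_ f → Injective _≡_ _≡_ f′ → bar f ≗ bar f′ → f ≗ f′
bar-reflects-≗ {f = f} {f′} f-injective f′-injective bar≗ k with ζ-surjective k
... | j , refl = τ≗τ′ j
  where
  hat≗ : hat (f ∘ ζ) ≗ hat (f′ ∘ ζ)
  hat≗ y = subst (λ z → hat (f ∘ ζ) z ≡ hat (f′ ∘ ζ) z) (Finₚ.opposite-involutive y) (bar≗ (opposite y))
  τ≗τ′ : f ∘ ζ ≗ f′ ∘ ζ
  τ≗τ′ = hat-reflects-≗ (ζ-injective ∘ f-injective) (ζ-injective ∘ f′-injective) hat≗

NoSuccession-resp-≗ : {g t : Fin n → Fin n} → g ≗ t → NoSuccession t → NoSuccession g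
NoSuccession-resp-≗ g≗t (at-start , later) =
  (λ i i≡0 → at-start i i≡0 ∘ subst (λ z → toℕ z ≡ 0) (g≗t i)) ,
  (λ i j adjacent → later i j adjacent ∘ subst₂ (λ a b → toℕ a ≡ suc (toℕ b)) (g≗t j) (g≗t i))

bar-onto-noSuccession : ∀ {m} (τ : Permutation′ (suc m)) → NoSuccession (τ ⟨$⟩ʳ_) →
                        Σ[ σ ∈ Permutation′ (suc m) ] (Derangement (σ ⟨$⟩ʳ_) × (bar (σ ⟨$⟩ʳ_) ≗ (τ ⟨$⟩ʳ_)))
bar-onto-noSuccession τ noSuccession =
  complete (surjective-on-injections bar bar-reflects-≗ (λ {f} → Bar.bar-injective f) (permutation-injective τ))
  where
  complete : (∃ λ f → Injective _≡_ _≡_ f × bar f ≗ (τ ⟨$⟩ʳ_)) →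
             Σ[ σ ∈ Permutation′ _ ] (Derangement (σ ⟨$⟩ʳ_) × (bar (σ ⟨$⟩ʳ_) ≗ (τ ⟨$⟩ʳ_)))
  complete (f , f-injective , bar≗τ) =
    σ , Bar.noSuccession⇒derangement f f-injective (NoSuccession-resp-≗ bar≗τ noSuccession) ,
    -- σ ⟨$⟩ʳ_ is f definitionally; going through subst avoids a costly unfolding of bar.
    subst (λ g → bar g ≗ (τ ⟨$⟩ʳ_)) {f} {σ ⟨$⟩ʳ_} refl bar≗τ
    where
    σ = injection⇒permutation f f-injective

mainTheorem7 : ∀ (n : ℕ) → n ≥ 1 →
    ((σ : Permutation′ n) → Derangement (σ ⟨$⟩ʳ_) →
        Injective _≡_ _≡_ (bar (σ ⟨$⟩ʳ_))
        × NoSuccession (bar (σ ⟨$⟩ʳ_))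
        × (E (σ ⟨$⟩ʳ_) ≗ M (bar (σ ⟨$⟩ʳ_))))
    × ((σ σ′ : Permutation′ n) → Derangement (σ ⟨$⟩ʳ_) → Derangement (σ′ ⟨$⟩ʳ_) →
        bar (σ ⟨$⟩ʳ_) ≗ bar (σ′ ⟨$⟩ʳ_) → (σ ⟨$⟩ʳ_) ≗ (σ′ ⟨$⟩ʳ_))
    × ((τ : Permutation′ n) → NoSuccession (τ ⟨$⟩ʳ_) →
        Σ[ σ ∈ Permutation′ n ] (Derangement (σ ⟨$⟩ʳ_) × (bar (σ ⟨$⟩ʳ_) ≗ (τ ⟨$⟩ʳ_))))
mainTheorem7 zero ()
mainTheorem7 (suc m) _ =
  (λ σ derangement → let open Bar (σ ⟨$⟩ʳ_) (permutation-injective σ)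
                     in bar-injective , bar-noSuccession derangement , E≗M) ,
  -- σ̄ determines σ for every permutation, deranged or not.
  (λ σ σ′ _ _ → bar-reflects-≗ (permutation-injective σ) (permutation-injective σ′)) ,
  bar-onto-noSuccession
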